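{- Let $G$ be an $n$-vertex maximal outerplanar graph, let $k\geq 3$ be an integer and let $0<c<1$ be a real number. Suppose that $G$ contains an edge $uv$ such that one of the two $uv$-split subgraphs of $G$, say $H$, has a set $\mathcal I_H\subseteq V(H)$ with $u\notin\mathcal I_H$, $v\notin \mathcal I_H$, $|\mathcal I_H|\geq c\cdot|V(H)|$, and $G[\mathcal I_H]$ of maximum degree at most $k$. Let $\overline H$ be the subgraph of $G$ induced by $V(G)\setminus V(H)$, and suppose $\overline H$ has a set $\mathcal I_{\overline H}\subseteq V(\overline H)$ with $|\mathcal I_{\overline H}|\geq c\cdot |V(\overline H)|$ and $G[\mathcal I_{\overline H}]$ of maximum degree at most $k$. Then $\mathcal I:=\mathcal I_H\cup\mathcal I_{\overline H}$ satisfies $|\mathcal I|\geq c\cdot n$ and $G[\mathcal I]$ has maximum degree at most $k$.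
   Context: A maximal outerplanar graph $G$ (an outerplanar graph to which no edge can be added keeping it simple and outerplanar) has a unique outerplanar drawing up to reflection and homeomorphism, whose outer face is bounded by a Hamiltonian cycle and whose internal faces are triangles. For an edge $uv$ of $G$, the two $uv$-split subgraphs of $G$ are the subgraphs induced by the vertices encountered when walking along the outer face from $u$ to $v$ clockwise, respectively counter-clockwise (both contain $u$, $v$ and the edge $uv$). $G[\mathcal I]$ denotes the subgraph induced by $\mathcal I$.
   Formalization: The constant $c$ ranges over the rationals with $0<c<1$ rather than over the real numbers. -}

module Defs where

open import Data.Bool using (Bool; true; false; _∧_; _∨_)
open import Data.Nat using (ℕ; zero; suc; _<_; _≤_; _∸_; _≤ᵇ_)
open import Data.Fin using (Fin; toℕ)
open import Data.Fin.Subset using (Subset; _∈_; _∩_; ∣_∣)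
open import Data.Vec using (tabulate)
open import Data.Product using (_×_; ∃; ∃-syntax)
open import Data.Sum using (_⊎_)
open import Data.Integer using (+_)
open import Data.Rational using (ℚ; _/_)
open import Relation.Binary.PropositionalEquality using (_≡_; _≢_)
open import Relation.Nullary using (¬_)

Graph : ℕ → Set
Graph n = Fin n → Fin n → Bool

Adj : ∀ {n} → Graph n → Fin n → Fin n → Set
Adj G x y = G x y ≡ true

-- Vertices are labelled 0,1,…,n-1 in the order in which they appear along
-- the outer face (Hamiltonian cycle) of the outerplanar drawing.
-- Cycle edges: {i, i+1} and {0, n-1}.
CycleEdge : ∀ {n} → Fin n → Fin n → Set
CycleEdge {n} x y =
  (suc (toℕ x) ≡ toℕ y) ⊎ (suc (toℕ y) ≡ toℕ x)
  ⊎ ((toℕ x ≡ 0) × (toℕ y ≡ n ∸ 1)) ⊎ ((toℕ y ≡ 0) × (toℕ x ≡ n ∸ 1))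

-- Two chords {a,b} and {c,d} of the convex polygon with vertices 0..n-1
-- (in convex position, in this cyclic order) cross iff their endpoints
-- strictly interleave.
Interleave : ℕ → ℕ → ℕ → ℕ → Set
Interleave a b c d = (a < c) × (c < b) × (b < d)

Cross : ∀ {n} → Fin n → Fin n → Fin n → Fin n → Set
Cross a b c d =
  Interleave (toℕ a) (toℕ b) (toℕ c) (toℕ d) ⊎ Interleave (toℕ b) (toℕ a) (toℕ c) (toℕ d)
  ⊎ Interleave (toℕ a) (toℕ b) (toℕ d) (toℕ c) ⊎ Interleave (toℕ b) (toℕ a) (toℕ d) (toℕ c)
  ⊎ Interleave (toℕ c) (toℕ d) (toℕ a) (toℕ b) ⊎ Interleave (toℕ d) (toℕ c) (toℕ a) (toℕ b)
  ⊎ Interleave (toℕ c) (toℕ d) (toℕ b) (toℕ a) ⊎ Interleave (toℕ d) (toℕ c) (toℕ b) (toℕ a)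

-- G (with its vertices labelled along the outer cycle) is a maximal
-- outerplanar graph: simple, contains the Hamiltonian outer cycle
-- 0,1,…,n-1, no two edges cross when drawn as straight chords of the
-- convex polygon, and no further edge can be added without a crossing
-- (i.e. every non-adjacent pair of distinct vertices crosses some edge).
record MaximalOuterplanar {n : ℕ} (G : Graph n) : Set where
  field
    atLeast3    : 3 ≤ n
    irreflexive : ∀ x → ¬ Adj G x x
    symmetric   : ∀ x y → Adj G x y → Adj G y x
    cycle       : ∀ x y → CycleEdge x y → Adj G x y
    noCrossing  : ∀ a b c d → Adj G a b → Adj G c d → ¬ Cross a b c d
    maximal     : ∀ x y → x ≢ y → ¬ Adj G x y →
                  ∃[ a ] ∃[ b ] (Adj G a b × Cross x y a b)

-- The two uv-split subgraphs' vertex sets: the vertices met walking along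
-- the outer cycle from u to v in each of the two directions.
splitIn : ∀ {n} → Fin n → Fin n → Subset n
splitIn u v = tabulate λ x →
  ((toℕ u ≤ᵇ toℕ x) ∧ (toℕ x ≤ᵇ toℕ v)) ∨ ((toℕ v ≤ᵇ toℕ x) ∧ (toℕ x ≤ᵇ toℕ u))

splitOut : ∀ {n} → Fin n → Fin n → Subset n
splitOut u v = tabulate λ x →
  ((toℕ x ≤ᵇ toℕ u) ∨ (toℕ v ≤ᵇ toℕ x)) ∧ ((toℕ x ≤ᵇ toℕ v) ∨ (toℕ u ≤ᵇ toℕ x))

nbhd : ∀ {n} → Graph n → Fin n → Subset n
nbhd G x = tabulate (G x)

MaxDegInducedLe : ∀ {n} → Graph n → Subset n → ℕ → Set
MaxDegInducedLe G S k = ∀ x → x ∈ S → ∣ S ∩ nbhd G x ∣ ≤ k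

toℚ : ℕ → ℚ
toℚ m = + m / 1

{-# OPTIONS --safe #-}
module Submission where

-- Label the vertices 0, …, n-1 along the outer cycle, so that edges are
-- non-crossing chords of a convex polygon. A vertex of H other than u, v lies
-- strictly on one side of the chord uv and a vertex of H̄ strictly on the
-- other, so an edge between them would cross uv. Hence G[I] is the disjoint
-- union of G[I_H] and G[I_H̄] with no edges in between, which gives the
-- degree bound; the size bound adds up because V(H) and V(H̄) partition V(G).

open import Defs
open import Data.Nat using (ℕ; _≤_)
open import Data.Fin using (Fin)
open import Data.Fin.Subset using (Subset; _∈_; _∉_; _⊆_; _∪_; ∁; ∣_∣)
open import Data.Product using (_×_)
open import Data.Sum using (_⊎_)
open import Data.Rational using (ℚ; 0ℚ; 1ℚ; _*_) renaming (_<_ to _<ℚ_; _≤_ to _≤ℚ_)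
open import Relation.Binary.PropositionalEquality using (_≡_)

open import Data.Bool using (Bool; true)
open import Data.Fin using (toℕ)
open import Data.Fin.Properties using (toℕ-injective)
open import Data.Fin.Subset using (inside; outside; _∩_)
open import Data.Fin.Subset.Properties
  using (drop-∷-⊆; x∈p∩q⁺; x∈p∩q⁻; x∈p∪q⁻; ∪-comm; x∈∁p⇒x∉p; x∉p⇒x∈∁p; p⊆q⇒∣p∣≤∣q∣; ∣∁p∣≡n∸∣p∣; ∣p∣≤n)
open import Data.Integer as ℤ using (+_)
import Data.Integer.Properties as ℤ
open import Data.Nat as ℕ using (_<_; suc; _≤?_)
open import Data.Nat.Properties using (≤∧≢⇒<; ≤-antisym; ≤-trans; ≰⇒>; <⇒≤; +-suc; m+[n∸m]≡n)
open import Data.Product using (_,_)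
open import Data.Rational using (_+_; toℚᵘ)
open import Data.Rational.Properties
  using (toℚᵘ-injective; toℚᵘ-fromℚᵘ; toℚᵘ-homo-+; *-distribˡ-+; +-mono-≤; module ≤-Reasoning)
import Data.Rational.Unnormalised as ℚᵘ
import Data.Rational.Unnormalised.Properties as ℚᵘ
open import Data.Sum using (inj₁; inj₂)
open import Data.Vec using (tabulate; _∷_; []; here)
open import Data.Vec.Properties using (lookup∘tabulate; []=⇒lookup; lookup⇒[]=)
open import Function using (_∘_)
open import Relation.Binary.PropositionalEquality using (refl; sym; trans; cong; cong₂; subst; subst₂; _≢_; ≢-sym)
open import Relation.Nullary using (¬_; Dec; does; yes; no; contradiction; _×-dec_; _⊎-dec_)
open import Relation.Nullary.Decidable using (dec-true)
open import Relation.Unary using (Pred; Decidable)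

toℚ-homo-+ : ∀ a b → toℚ (a ℕ.+ b) ≡ toℚ a + toℚ b
-- toℚ m is definitionally fromℚᵘ (mkℚᵘ (+ m) 0).
toℚ-homo-+ a b = toℚᵘ-injective (begin
  toℚᵘ (toℚ (a ℕ.+ b))                   ≈⟨ toℚᵘ-fromℚᵘ (ℚᵘ.mkℚᵘ (+ (a ℕ.+ b)) 0) ⟩
  ℚᵘ.mkℚᵘ (+ (a ℕ.+ b)) 0                ≈⟨ ℚᵘ.*≡* (cong (ℤ._* + 1) +[a+b]≡a*1+b*1) ⟩
  ℚᵘ.mkℚᵘ (+ a) 0 ℚᵘ.+ ℚᵘ.mkℚᵘ (+ b) 0   ≈⟨ ℚᵘ.+-cong (embed a) (embed b) ⟩
  toℚᵘ (toℚ a) ℚᵘ.+ toℚᵘ (toℚ b)         ≈⟨ ℚᵘ.≃-sym (toℚᵘ-homo-+ (toℚ a) (toℚ b)) ⟩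
  toℚᵘ (toℚ a + toℚ b)                   ∎)
  where
  open ℚᵘ.≃-Reasoning
  +[a+b]≡a*1+b*1 : + (a ℕ.+ b) ≡ + a ℤ.* + 1 ℤ.+ + b ℤ.* + 1
  +[a+b]≡a*1+b*1 = trans (ℤ.pos-+ a b) (sym (cong₂ ℤ._+_ (ℤ.*-identityʳ (+ a)) (ℤ.*-identityʳ (+ b))))
  embed : ∀ m → ℚᵘ.mkℚᵘ (+ m) 0 ℚᵘ.≃ toℚᵘ (toℚ m)
  embed m = ℚᵘ.≃-sym (toℚᵘ-fromℚᵘ (ℚᵘ.mkℚᵘ (+ m) 0))

fraction-+ : ∀ (c : ℚ) {p q a b} → c * toℚ p ≤ℚ toℚ a → c * toℚ q ≤ℚ toℚ b →
             c * toℚ (p ℕ.+ q) ≤ℚ toℚ (a ℕ.+ b)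
fraction-+ c {p} {q} {a} {b} cp≤a cq≤b = begin
  c * toℚ (p ℕ.+ q)          ≡⟨ cong (c *_) (toℚ-homo-+ p q) ⟩
  c * (toℚ p + toℚ q)        ≡⟨ *-distribˡ-+ c (toℚ p) (toℚ q) ⟩
  c * toℚ p + c * toℚ q      ≤⟨ +-mono-≤ cp≤a cq≤b ⟩
  toℚ a + toℚ b              ≡⟨ sym (toℚ-homo-+ a b) ⟩
  toℚ (a ℕ.+ b)              ∎
  where open ≤-Reasoning

∣p∪q∣≡∣p∣+∣q∣ : ∀ {n} {p q : Subset n} → p ⊆ ∁ q → ∣ p ∪ q ∣ ≡ ∣ p ∣ ℕ.+ ∣ q ∣
∣p∪q∣≡∣p∣+∣q∣ {p = []}          {[]}          _    = refl
∣p∪q∣≡∣p∣+∣q∣ {p = inside  ∷ p} {inside  ∷ q} p⊆∁q = contradiction (p⊆∁q here) λ ()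
∣p∪q∣≡∣p∣+∣q∣ {p = inside  ∷ p} {outside ∷ q} p⊆∁q = cong suc (∣p∪q∣≡∣p∣+∣q∣ (drop-∷-⊆ p⊆∁q))
∣p∪q∣≡∣p∣+∣q∣ {p = outside ∷ p} {inside  ∷ q} p⊆∁q =
  trans (cong suc (∣p∪q∣≡∣p∣+∣q∣ (drop-∷-⊆ p⊆∁q))) (sym (+-suc ∣ p ∣ ∣ q ∣))
∣p∪q∣≡∣p∣+∣q∣ {p = outside ∷ p} {outside ∷ q} p⊆∁q = ∣p∪q∣≡∣p∣+∣q∣ (drop-∷-⊆ p⊆∁q)

∣p∣+∣∁p∣≡n : ∀ {n} (p : Subset n) → ∣ p ∣ ℕ.+ ∣ ∁ p ∣ ≡ n
∣p∣+∣∁p∣≡n p = trans (cong (∣ p ∣ ℕ.+_) (∣∁p∣≡n∸∣p∣ p)) (m+[n∸m]≡n (∣p∣≤n p))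

module _ {n} {f : Fin n → Bool} {x : Fin n} where

  ∈-tabulate⁻ : x ∈ tabulate f → f x ≡ true
  ∈-tabulate⁻ x∈ = trans (sym (lookup∘tabulate f x)) ([]=⇒lookup x∈)

  ∈-tabulate⁺ : f x ≡ true → x ∈ tabulate f
  ∈-tabulate⁺ fx = lookup⇒[]= x (tabulate f) (trans (lookup∘tabulate f x) fx)

module _ {n p} {P : Pred (Fin n) p} (P? : Decidable P) {x : Fin n} where

  ∈-tabulate-does⁻ : x ∈ tabulate (does ∘ P?) → P x
  ∈-tabulate-does⁻ x∈ with P? x | ∈-tabulate⁻ x∈
  ... | yes px | _  = px
  ... | no  _  | ()

  ∉-tabulate-does⁻ : x ∉ tabulate (does ∘ P?) → ¬ P x
  ∉-tabulate-does⁻ x∉ px = x∉ (∈-tabulate⁺ (dec-true (P? x) px))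

Between : ℕ → ℕ → ℕ → Set
Between a b z = (a ≤ z × z ≤ b) ⊎ (b ≤ z × z ≤ a)

between? : ∀ a b z → Dec (Between a b z)
between? a b z = (a ≤? z ×-dec z ≤? b) ⊎-dec (b ≤? z ×-dec z ≤? a)

StrictlyBetween : ℕ → ℕ → ℕ → Set
StrictlyBetween a b z = (a < z × z < b) ⊎ (b < z × z < a)

Outside : ℕ → ℕ → ℕ → Set
Outside a b z = (z ≤ a ⊎ b ≤ z) × (z ≤ b ⊎ a ≤ z)

outside? : ∀ a b z → Dec (Outside a b z)
outside? a b z = (z ≤? a ⊎-dec b ≤? z) ×-dec (z ≤? b ⊎-dec a ≤? z)

StrictlyOutside : ℕ → ℕ → ℕ → Set
StrictlyOutside a b z = (z < a × z < b) ⊎ (a < z × b < z)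

module _ {a b z : ℕ} where

  between⇒strictlyBetween : Between a b z → z ≢ a → z ≢ b → StrictlyBetween a b z
  between⇒strictlyBetween (inj₁ (a≤z , z≤b)) z≢a z≢b = inj₁ (≤∧≢⇒< a≤z (≢-sym z≢a) , ≤∧≢⇒< z≤b z≢b)
  between⇒strictlyBetween (inj₂ (b≤z , z≤a)) z≢a z≢b = inj₂ (≤∧≢⇒< b≤z (≢-sym z≢b) , ≤∧≢⇒< z≤a z≢a)

  outside⇒strictlyOutside : Outside a b z → z ≢ a → z ≢ b → StrictlyOutside a b z
  outside⇒strictlyOutside (inj₁ z≤a , inj₁ z≤b) z≢a z≢b = inj₁ (≤∧≢⇒< z≤a z≢a , ≤∧≢⇒< z≤b z≢b)
  outside⇒strictlyOutside (inj₁ z≤a , inj₂ a≤z) z≢a z≢b = contradiction (≤-antisym z≤a a≤z) z≢a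
  outside⇒strictlyOutside (inj₂ b≤z , inj₁ z≤b) z≢a z≢b = contradiction (≤-antisym z≤b b≤z) z≢b
  outside⇒strictlyOutside (inj₂ b≤z , inj₂ a≤z) z≢a z≢b = inj₂ (≤∧≢⇒< a≤z (≢-sym z≢a) , ≤∧≢⇒< b≤z (≢-sym z≢b))

  ¬between⇒strictlyOutside : ¬ Between a b z → StrictlyOutside a b z
  ¬between⇒strictlyOutside ¬btw with a ≤? z | b ≤? z
  ... | yes a≤z | yes b≤z = inj₂ (≰⇒> (λ z≤a → ¬btw (inj₂ (b≤z , z≤a))) , ≰⇒> (λ z≤b → ¬btw (inj₁ (a≤z , z≤b))))
  ... | yes a≤z | no  b≰z = contradiction (inj₁ (a≤z , <⇒≤ (≰⇒> b≰z))) ¬btw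
  ... | no  a≰z | yes b≤z = contradiction (inj₂ (b≤z , <⇒≤ (≰⇒> a≰z))) ¬btw
  ... | no  a≰z | no  b≰z = inj₁ (≰⇒> a≰z , ≰⇒> b≰z)

  ¬outside⇒strictlyBetween : ¬ Outside a b z → StrictlyBetween a b z
  ¬outside⇒strictlyBetween ¬out with z ≤? a | z ≤? b
  ... | yes z≤a | yes z≤b = contradiction (inj₁ z≤a , inj₁ z≤b) ¬out
  ... | yes z≤a | no  z≰b = inj₂ (≰⇒> z≰b , ≰⇒> (λ a≤z → ¬out (inj₁ z≤a , inj₂ a≤z)))
  ... | no  z≰a | yes z≤b = inj₁ (≰⇒> z≰a , ≰⇒> (λ b≤z → ¬out (inj₂ b≤z , inj₁ z≤b)))
  ... | no  z≰a | no  z≰b = contradiction (inj₂ (<⇒≤ (≰⇒> z≰b)) , inj₂ (<⇒≤ (≰⇒> z≰a))) ¬out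

strictlyBetween×strictlyOutside⇒Cross : ∀ {n} {a b x y : Fin n} →
  StrictlyBetween (toℕ a) (toℕ b) (toℕ x) → StrictlyOutside (toℕ a) (toℕ b) (toℕ y) → Cross x y a b
strictlyBetween×strictlyOutside⇒Cross (inj₁ (a<x , x<b)) (inj₁ (y<a , _)) = inj₂ (inj₁ (y<a , a<x , x<b))
strictlyBetween×strictlyOutside⇒Cross (inj₁ (a<x , x<b)) (inj₂ (_ , b<y)) = inj₂ (inj₂ (inj₂ (inj₂ (inj₁ (a<x , x<b , b<y)))))
strictlyBetween×strictlyOutside⇒Cross (inj₂ (b<x , x<a)) (inj₁ (_ , y<b)) = inj₂ (inj₂ (inj₂ (inj₁ (y<b , b<x , x<a))))
strictlyBetween×strictlyOutside⇒Cross (inj₂ (b<x , x<a)) (inj₂ (a<y , _)) = inj₂ (inj₂ (inj₂ (inj₂ (inj₂ (inj₁ (b<x , x<a , a<y))))))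

module _ {n} (u v : Fin n) {x : Fin n} where

  ∈-splitIn⁻ : x ∈ splitIn u v → Between (toℕ u) (toℕ v) (toℕ x)
  ∈-splitIn⁻ = ∈-tabulate-does⁻ (λ y → between? (toℕ u) (toℕ v) (toℕ y))

  ∉-splitIn⁻ : x ∉ splitIn u v → ¬ Between (toℕ u) (toℕ v) (toℕ x)
  ∉-splitIn⁻ = ∉-tabulate-does⁻ (λ y → between? (toℕ u) (toℕ v) (toℕ y))

  ∈-splitOut⁻ : x ∈ splitOut u v → Outside (toℕ u) (toℕ v) (toℕ x)
  ∈-splitOut⁻ = ∈-tabulate-does⁻ (λ y → outside? (toℕ u) (toℕ v) (toℕ y))

  ∉-splitOut⁻ : x ∉ splitOut u v → ¬ Outside (toℕ u) (toℕ v) (toℕ x)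
  ∉-splitOut⁻ = ∉-tabulate-does⁻ (λ y → outside? (toℕ u) (toℕ v) (toℕ y))

module _ {n} {G : Graph n} (M : MaximalOuterplanar G) {u v : Fin n} (uv : Adj G u v) where
  open MaximalOuterplanar M using (symmetric; noCrossing)

  splitIn-noEdge : ∀ {x y} → x ∈ splitIn u v → x ≢ u → x ≢ v → y ∉ splitIn u v → ¬ Adj G x y
  splitIn-noEdge {x} {y} x∈ x≢u x≢v y∉ xy = noCrossing x y u v xy uv
    (strictlyBetween×strictlyOutside⇒Cross
      (between⇒strictlyBetween (∈-splitIn⁻ u v x∈) (x≢u ∘ toℕ-injective) (x≢v ∘ toℕ-injective))
      (¬between⇒strictlyOutside (∉-splitIn⁻ u v y∉)))

  splitOut-noEdge : ∀ {x y} → x ∈ splitOut u v → x ≢ u → x ≢ v → y ∉ splitOut u v → ¬ Adj G x y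
  splitOut-noEdge {x} {y} x∈ x≢u x≢v y∉ xy = noCrossing y x u v (symmetric x y xy) uv
    (strictlyBetween×strictlyOutside⇒Cross
      (¬outside⇒strictlyBetween (∉-splitOut⁻ u v y∉))
      (outside⇒strictlyOutside (∈-splitOut⁻ u v x∈) (x≢u ∘ toℕ-injective) (x≢v ∘ toℕ-injective)))

  split-noEdge : ∀ {VH x y} → VH ≡ splitIn u v ⊎ VH ≡ splitOut u v →
                 x ∈ VH → x ≢ u → x ≢ v → y ∉ VH → ¬ Adj G x y
  split-noEdge (inj₁ refl) = splitIn-noEdge
  split-noEdge (inj₂ refl) = splitOut-noEdge

module _ {n} (G : Graph n) where

  ∪∩nbhd⊆ : ∀ {S T x} → (∀ {y} → y ∈ T → ¬ Adj G x y) → (S ∪ T) ∩ nbhd G x ⊆ S ∩ nbhd G x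
  ∪∩nbhd⊆ {S} {T} {x} noAdj z∈ with x∈p∩q⁻ (S ∪ T) (nbhd G x) z∈
  ... | z∈S∪T , z∈N with x∈p∪q⁻ S T z∈S∪T
  ...   | inj₁ z∈S = x∈p∩q⁺ (z∈S , z∈N)
  ...   | inj₂ z∈T = contradiction (∈-tabulate⁻ z∈N) (noAdj z∈T)

  MaxDegInducedLe-∪ : ∀ {S T k} → (∀ x y → Adj G x y → Adj G y x) →
                      (∀ {x y} → x ∈ S → y ∈ T → ¬ Adj G x y) →
                      MaxDegInducedLe G S k → MaxDegInducedLe G T k → MaxDegInducedLe G (S ∪ T) k
  MaxDegInducedLe-∪ {S} {T} sym-adj noAdj degS degT x x∈S∪T with x∈p∪q⁻ S T x∈S∪T
  ... | inj₁ x∈S = ≤-trans (p⊆q⇒∣p∣≤∣q∣ (∪∩nbhd⊆ {S} {T} (noAdj x∈S))) (degS x x∈S)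
  ... | inj₂ x∈T = ≤-trans (p⊆q⇒∣p∣≤∣q∣ N⊆T∩N) (degT x x∈T)
    where
    N⊆T∩N : (S ∪ T) ∩ nbhd G x ⊆ T ∩ nbhd G x
    N⊆T∩N = subst (λ R → R ∩ nbhd G x ⊆ T ∩ nbhd G x) (∪-comm T S)
                  (∪∩nbhd⊆ {T} {S} (λ y∈S xy → noAdj y∈S x∈T (sym-adj x _ xy)))

lemma4 : (n : ℕ) (G : Graph n) → MaximalOuterplanar G →
    (k : ℕ) → 3 ≤ k → (c : ℚ) → 0ℚ <ℚ c → c <ℚ 1ℚ →
    (u v : Fin n) → Adj G u v →
    (VH : Subset n) → (VH ≡ splitIn u v ⊎ VH ≡ splitOut u v) →
    (IH : Subset n) → IH ⊆ VH → u ∉ IH → v ∉ IH →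
    c * toℚ ∣ VH ∣ ≤ℚ toℚ ∣ IH ∣ → MaxDegInducedLe G IH k →
    (IHbar : Subset n) → IHbar ⊆ ∁ VH →
    c * toℚ ∣ ∁ VH ∣ ≤ℚ toℚ ∣ IHbar ∣ → MaxDegInducedLe G IHbar k →
    (c * toℚ n ≤ℚ toℚ ∣ IH ∪ IHbar ∣) × MaxDegInducedLe G (IH ∪ IHbar) k
lemma4 n G M k _ c _ _ u v uv VH split IH IH⊆VH u∉IH v∉IH cVH≤IH degIH IHbar IHbar⊆∁VH c∁VH≤IHbar degIHbar =
  density , MaxDegInducedLe-∪ G (MaximalOuterplanar.symmetric M) noAdj degIH degIHbar
  where
  noAdj : ∀ {x y} → x ∈ IH → y ∈ IHbar → ¬ Adj G x y
  noAdj x∈IH y∈IHbar = split-noEdge M uv split (IH⊆VH x∈IH)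
    (λ { refl → u∉IH x∈IH }) (λ { refl → v∉IH x∈IH }) (x∈∁p⇒x∉p (IHbar⊆∁VH y∈IHbar))

  IH⊆∁IHbar : IH ⊆ ∁ IHbar
  IH⊆∁IHbar x∈IH = x∉p⇒x∈∁p (λ x∈IHbar → x∈∁p⇒x∉p (IHbar⊆∁VH x∈IHbar) (IH⊆VH x∈IH))

  density : c * toℚ n ≤ℚ toℚ ∣ IH ∪ IHbar ∣
  density = subst₂ (λ m i → c * toℚ m ≤ℚ toℚ i) (∣p∣+∣∁p∣≡n VH) (sym (∣p∪q∣≡∣p∣+∣q∣ IH⊆∁IHbar))
                   (fraction-+ c {∣ VH ∣} {∣ ∁ VH ∣} {∣ IH ∣} {∣ IHbar ∣} cVH≤IH c∁VH≤IHbar)
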